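{- For every Cayley permutation $y$ we have $[y]=\mathcal B(\gamma(y))$. Moreover, for every permutation $\sigma$ we have $\mathcal B(\sigma)=[\sigma^{ -1}]$.
   Context: A Cayley permutation of length $n$ is a word of positive integers in which every integer from $1$ to its maximum occurs; $\mathrm{WI}_n$ is the set of weakly increasing ones; $\mathrm{id}_n=12\cdots n$; $\sigma^{ -1}$ is the inverse permutation. $\mathrm{Des}(v)=\{i: v(i)\ge v(i+1)\}$. For a weakly increasing Cayley permutation $u$ and a Cayley permutation $v$ of the same length, the Burge transpose $(u,v)^T$ of the biword with columns $\binom{u(i)}{v(i)}$ is obtained by turning every column upside down and then sorting the columns in increasing order of top entry, ties broken by decreasing bottom entry. For $x$ of length $n$, $\gamma(x)$ is the bottom row of $(\mathrm{id}_n,x)^T$; $x\sim y$ iff $\gamma(x)=\gamma(y)$ and $[y]$ is the class of $y$. For $\pi\in S_n$ let $\mathrm{WI}(\pi)=\{u\in\mathrm{WI}_n:\mathrm{Des}(u)\subseteq\mathrm{Des}(\pi)\}$; the Fishburn basis $\mathcal B(\pi)$ is defined by $\{(u,\pi)^T:u\in\mathrm{WI}(\pi)\}=\{\mathrm{id}_n\}\times\mathcal B(\pi)$ (each such transpose has top row $\mathrm{id}_n$, and $\mathcal B(\pi)$ is the set of their bottom rows). -}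

module Defs where

open import Data.Nat using (ℕ; zero; suc; _≤_; _<_; _⊔_; _≤?_; _<?_; _≟_)
open import Data.Nat.Properties using ()
open import Data.List using (List; []; _∷_; map; zip; unzip; length; upTo; foldr)
open import Data.List.Relation.Unary.All using (All)
open import Data.List.Membership.Propositional using (_∈_)
open import Data.List.Relation.Binary.Permutation.Propositional using (_↭_)
open import Data.Product using (_×_; _,_; Σ; ∃; ∃-syntax; swap; proj₂)
open import Data.Maybe using (Maybe; just; nothing)
open import Data.Bool using (Bool; true; false; if_then_else_; _∨_; _∧_)
open import Relation.Nullary.Decidable using (⌊_⌋)
open import Relation.Binary.PropositionalEquality using (_≡_)

-- Words are lists of naturals; positions are 0-based internally.
Word : Set
Word = List ℕ

maxW : Word → ℕ
maxW = foldr _⊔_ 0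

IsCayley : Word → Set
IsCayley w = All (1 ≤_) w × (∀ k → 1 ≤ k → k ≤ maxW w → k ∈ w)

idW : ℕ → Word
idW n = map suc (upTo n)

IsPerm : Word → Set
IsPerm w = w ↭ idW (length w)

data WeaklyInc : Word → Set where
  wi-nil  : WeaklyInc []
  wi-one  : ∀ a → WeaklyInc (a ∷ [])
  wi-cons : ∀ a b w → a ≤ b → WeaklyInc (b ∷ w) → WeaklyInc (a ∷ b ∷ w)

at : Word → ℕ → Maybe ℕ
at []       _       = nothing
at (a ∷ w)  zero    = just a
at (a ∷ w)  (suc i) = at w i

-- i ∈ Des(v) (0-based position i, i.e. paper position i+1):  v(i) ≥ v(i+1)
InDes : Word → ℕ → Set
InDes v i = ∃[ a ] ∃[ b ] (at v i ≡ just a × at v (suc i) ≡ just b × b ≤ a)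

DesSub : Word → Word → Set
DesSub u v = ∀ i → InDes u i → InDes v i

InWI : Word → Word → Set
InWI π u = IsCayley u × WeaklyInc u × length u ≡ length π × DesSub u π

-- Column order for the Burge transpose: increasing top, ties by decreasing bottom.
colLeq : ℕ × ℕ → ℕ × ℕ → Bool
colLeq (a , b) (c , d) = ⌊ a <? c ⌋ ∨ (⌊ a ≟ c ⌋ ∧ ⌊ d ≤? b ⌋)

insertCol : ℕ × ℕ → List (ℕ × ℕ) → List (ℕ × ℕ)
insertCol p []       = p ∷ []
insertCol p (q ∷ qs) = if colLeq p q then p ∷ q ∷ qs else q ∷ insertCol p qs

sortCols : List (ℕ × ℕ) → List (ℕ × ℕ)
sortCols = foldr insertCol []

-- Burge transpose of the biword with top row u and bottom row v
-- (columns (u(i), v(i))); result given as (top row, bottom row).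
burgeT : Word → Word → Word × Word
burgeT u v = unzip (sortCols (map swap (zip u v)))

γ : Word → Word
γ x = proj₂ (burgeT (idW (length x)) x)

InClass : Word → Word → Set
InClass y x = IsCayley x × γ x ≡ γ y

InB : Word → Word → Set
InB π x = ∃[ u ] (InWI π u × burgeT u π ≡ (idW (length π) , x))

-- 1-based position of the first occurrence of j in w
pos : ℕ → Word → ℕ
pos j []      = 0
pos j (a ∷ w) = if ⌊ j ≟ a ⌋ then 1 else suc (pos j w)

invP : Word → Word
invP σ = map (λ j → pos j σ) (idW (length σ))

-- Sorting columns by increasing top entry, ties by decreasing bottom entry, is sorting with
-- respect to a total order, so it returns the unique sorted arrangement of a multiset of
-- columns; hence the Burge transpose is an involution on sorted biwords.  A biword (u , π)
-- with equal rows is sorted exactly when u is weakly increasing with Des u ⊆ Des π, and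
-- (id , x) is always sorted.  So (u , π)ᵀ = (id , x) for some u ∈ WI(π) iff (id , x)ᵀ has
-- bottom row π, i.e. γ x = π; Cayley-ness transfers between x and u because transposition
-- only permutes the entries of each row.  For a permutation σ, flipping the columns of
-- (id , σ⁻¹) gives the columns of (id , σ), whence γ(σ⁻¹) = σ.
module Submission where

open import Defs
open import Data.Bool using (T; true; false)
open import Data.Bool.Properties using (T-∨; T-∧)
open import Data.Empty using (⊥-elim)
open import Data.List using (List; []; _∷_; map; zip; unzip; length; applyUpTo)
import Data.List.Properties as List
open import Data.List.Relation.Binary.Permutation.Propositional
  using (_↭_; ↭-sym; ↭-trans; ↭⇒↭ₛ; module PermutationReasoning)
import Data.List.Relation.Binary.Permutation.Propositional.Properties as ↭
open import Data.List.Relation.Binary.Pointwise using (Pointwise-≡⇒≡)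
import Data.List.Relation.Unary.All as All
open import Data.List.Relation.Unary.AllPairs using (_∷_)
open import Data.List.Relation.Unary.Linked using (Linked; []; [-]; _∷_)
open import Data.List.Relation.Unary.Unique.Propositional using (Unique)
import Data.List.Relation.Unary.Unique.Propositional.Properties as Unique
open import Data.Nat using (ℕ; zero; suc; _≤_; _<_; _≟_; _<?_; _≤?_)
import Data.Nat.Properties as ℕ
open import Data.Product using (_×_; _,_; proj₁; proj₂; swap; map₁; uncurry′)
open import Data.Product.Properties using (≡-dec)
open import Data.Sum as Sum using (_⊎_; inj₁; inj₂)
open import Function using (_∘_; id)
open import Function.Bundles using (_⇔_; mk⇔; Equivalence)
open import Function.Construct.Symmetry using (⇔-sym)
open import Relation.Binary.Bundles using (DecTotalOrder)
open import Relation.Binary.Definitions using (tri<; tri≈; tri>)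
open import Relation.Binary.PropositionalEquality
open import Data.List.Relation.Binary.Permutation.Setoid.Properties (setoid ℕ)
  using (foldr-commMonoid; Unique-resp-↭)
open import Relation.Nullary using (yes; no)
open import Relation.Nullary.Decidable using (⌊_⌋; T?; toWitness; fromWitness)

Column : Set
Column = ℕ × ℕ

infix 4 _⊑_

data _⊑_ : Column → Column → Set where
  top< : ∀ {a b c d} → a < c → (a , b) ⊑ (c , d)
  top≡ : ∀ {a b d} → d ≤ b → (a , b) ⊑ (a , d)

⊑⇒colLeq : ∀ {p q} → p ⊑ q → T (colLeq p q)
⊑⇒colLeq (top< {a} {c = c} a<c) = Equivalence.from (T-∨ {⌊ a <? c ⌋}) (inj₁ (fromWitness a<c))
⊑⇒colLeq (top≡ {a} {b} {d} d≤b) = Equivalence.from (T-∨ {⌊ a <? a ⌋}) (inj₂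
  (Equivalence.from (T-∧ {⌊ a ≟ a ⌋} {⌊ d ≤? b ⌋}) (fromWitness refl , fromWitness d≤b)))

colLeq⇒⊑ : ∀ p q → T (colLeq p q) → p ⊑ q
colLeq⇒⊑ (a , b) (c , d) le with Equivalence.to T-∨ le
... | inj₁ a<c = top< (toWitness a<c)
... | inj₂ a≡c∧d≤b with Equivalence.to T-∧ a≡c∧d≤b
... | a≡c , d≤b with toWitness {a? = a ≟ c} a≡c
... | refl = top≡ (toWitness d≤b)

⊑-reflexive : ∀ {p q} → p ≡ q → p ⊑ q
⊑-reflexive refl = top≡ ℕ.≤-refl

⊑-trans : ∀ {p q r} → p ⊑ q → q ⊑ r → p ⊑ r
⊑-trans (top< a<b) (top< b<c) = top< (ℕ.<-trans a<b b<c)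
⊑-trans (top< a<b) (top≡ _)   = top< a<b
⊑-trans (top≡ _)   (top< b<c) = top< b<c
⊑-trans (top≡ x)   (top≡ y)   = top≡ (ℕ.≤-trans y x)

⊑-antisym : ∀ {p q} → p ⊑ q → q ⊑ p → p ≡ q
⊑-antisym (top< a<c) (top< c<a) = ⊥-elim (ℕ.<-asym a<c c<a)
⊑-antisym (top< a<a) (top≡ _)   = ⊥-elim (ℕ.<-irrefl refl a<a)
⊑-antisym (top≡ _)   (top< a<a) = ⊥-elim (ℕ.<-irrefl refl a<a)
⊑-antisym (top≡ d≤b) (top≡ b≤d) = cong (_ ,_) (ℕ.≤-antisym b≤d d≤b)

⊑-total : ∀ p q → p ⊑ q ⊎ q ⊑ p
⊑-total (a , b) (c , d) with ℕ.<-cmp a c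
... | tri< a<c _ _ = inj₁ (top< a<c)
... | tri> _ _ c<a = inj₂ (top< c<a)
... | tri≈ _ refl _ with ℕ.≤-total d b
...   | inj₁ d≤b = inj₁ (top≡ d≤b)
...   | inj₂ b≤d = inj₂ (top≡ b≤d)

-- Ordered by T ∘ colLeq so that the library's insertion sort branches exactly like insertCol.
columnOrder : DecTotalOrder _ _ _
columnOrder = record
  { Carrier = Column
  ; _≈_ = _≡_
  ; _≤_ = λ p q → T (colLeq p q)
  ; isDecTotalOrder = record
    { isTotalOrder = record
      { isPartialOrder = record
        { isPreorder = record
          { isEquivalence = isEquivalence
          ; reflexive = ⊑⇒colLeq ∘ ⊑-reflexive
          ; trans = λ {p} {q} {r} p≤q q≤r →
              ⊑⇒colLeq (⊑-trans (colLeq⇒⊑ p q p≤q) (colLeq⇒⊑ q r q≤r))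
          }
        ; antisym = λ {p} {q} p≤q q≤p → ⊑-antisym (colLeq⇒⊑ p q p≤q) (colLeq⇒⊑ q p q≤p)
        }
      ; total = λ p q → Sum.map ⊑⇒colLeq ⊑⇒colLeq (⊑-total p q)
      }
    ; _≟_ = ≡-dec ℕ._≟_ ℕ._≟_
    ; _≤?_ = λ p q → T? (colLeq p q)
    }
  }

open import Data.List.Sort.InsertionSort.Base columnOrder using (insert; sort)
open import Data.List.Sort.InsertionSort.Properties columnOrder using (sort-↭; sort-↗)
open import Data.List.Relation.Unary.Sorted.TotalOrder (DecTotalOrder.totalOrder columnOrder)
  using (Sorted)
open import Data.List.Relation.Unary.Sorted.TotalOrder.Properties using (↗↭↗⇒≋)

insertCol≡insert : ∀ p L → insertCol p L ≡ insert p L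
insertCol≡insert p []      = refl
insertCol≡insert p (q ∷ L) with colLeq p q
... | true  = refl
... | false = cong (q ∷_) (insertCol≡insert p L)

sortCols≡sort : ∀ L → sortCols L ≡ sort L
sortCols≡sort []      = refl
sortCols≡sort (p ∷ L) = trans (cong (insertCol p) (sortCols≡sort L)) (insertCol≡insert p (sort L))

sortCols-↗ : ∀ L → Sorted (sortCols L)
sortCols-↗ L = subst Sorted (sym (sortCols≡sort L)) (sort-↗ L)

sortCols-↭ : ∀ L → sortCols L ↭ L
sortCols-↭ L = subst (_↭ L) (sym (sortCols≡sort L)) (sort-↭ L)

sortCols-unique : ∀ {L M} → Sorted L → L ↭ M → sortCols M ≡ L
sortCols-unique {L} {M} L↗ L↭M = Pointwise-≡⇒≡
  (↗↭↗⇒≋ (DecTotalOrder.totalOrder columnOrder) (sortCols-↗ M) L↗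
    (↭⇒↭ₛ (↭-trans (sortCols-↭ M) (↭-sym L↭M))))

transposeCols : List Column → List Column
transposeCols L = sortCols (map swap L)

transposeCols-↗ : ∀ L → Sorted (transposeCols L)
transposeCols-↗ L = sortCols-↗ (map swap L)

transposeCols-↭ : ∀ L → transposeCols L ↭ map swap L
transposeCols-↭ L = sortCols-↭ (map swap L)

map-swap-involutive : ∀ {A B : Set} (L : List (A × B)) → map swap (map swap L) ≡ L
map-swap-involutive L = trans (sym (List.map-∘ L)) (List.map-id L)

transposeCols-involutive : ∀ {L} → Sorted L → transposeCols (transposeCols L) ≡ L
transposeCols-involutive {L} L↗ = sortCols-unique L↗ (begin
  L                               ≡⟨ map-swap-involutive L ⟨
  map swap (map swap L)           ↭⟨ ↭.map⁺ swap (transposeCols-↭ L) ⟨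
  map swap (transposeCols L)      ∎)
  where open PermutationReasoning

top-transposeCols-↭ : ∀ L → map proj₁ (transposeCols L) ↭ map proj₂ L
top-transposeCols-↭ L = subst (map proj₁ (transposeCols L) ↭_) (sym (List.map-∘ L))
  (↭.map⁺ proj₁ (transposeCols-↭ L))

bottom-transposeCols-↭ : ∀ L → map proj₂ (transposeCols L) ↭ map proj₁ L
bottom-transposeCols-↭ L = subst (map proj₂ (transposeCols L) ↭_) (sym (List.map-∘ L))
  (↭.map⁺ proj₂ (transposeCols-↭ L))

⊑⇒top≤ : ∀ {p q} → p ⊑ q → proj₁ p ≤ proj₁ q
⊑⇒top≤ (top< a<c) = ℕ.<⇒≤ a<c
⊑⇒top≤ (top≡ _)   = ℕ.≤-refl

⊑⇒tie : ∀ {p q} → p ⊑ q → proj₁ q ≤ proj₁ p → proj₂ q ≤ proj₂ p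
⊑⇒tie (top< a<c) c≤a = ⊥-elim (ℕ.<-irrefl refl (ℕ.<-≤-trans a<c c≤a))
⊑⇒tie (top≡ d≤b) _   = d≤b

≤∧tie⇒⊑ : ∀ {a b c d} → a ≤ c → (a ≡ c → d ≤ b) → (a , b) ⊑ (c , d)
≤∧tie⇒⊑ a≤c tie with ℕ.m≤n⇒m<n∨m≡n a≤c
... | inj₁ a<c  = top< a<c
... | inj₂ refl = top≡ (tie refl)

Sorted⇒WeaklyInc : ∀ {L} → Sorted L → WeaklyInc (map proj₁ L)
Sorted⇒WeaklyInc []                  = wi-nil
Sorted⇒WeaklyInc [-]                 = wi-one _
Sorted⇒WeaklyInc (_∷_ {p} {q} p≤q L↗) =
  wi-cons _ _ _ (⊑⇒top≤ (colLeq⇒⊑ p q p≤q)) (Sorted⇒WeaklyInc L↗)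

Sorted⇒DesSub : ∀ {L} → Sorted L → DesSub (map proj₁ L) (map proj₂ L)
Sorted⇒DesSub []  _       (_ , _ , () , _)
Sorted⇒DesSub [-] zero    (_ , _ , _ , () , _)
Sorted⇒DesSub [-] (suc _) (_ , _ , () , _)
Sorted⇒DesSub (_∷_ {p} {q} p≤q _) zero (_ , _ , refl , refl , q≤p) =
  _ , _ , refl , refl , ⊑⇒tie (colLeq⇒⊑ p q p≤q) q≤p
Sorted⇒DesSub (_ ∷ L↗) (suc i) i∈Des = Sorted⇒DesSub L↗ i i∈Des

WeaklyInc∧DesSub⇒Sorted : ∀ {u v} → WeaklyInc u → DesSub u v → Sorted (zip u v)
WeaklyInc∧DesSub⇒Sorted wi-nil _ = []
WeaklyInc∧DesSub⇒Sorted {v = []}    (wi-one _) _ = []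
WeaklyInc∧DesSub⇒Sorted {v = _ ∷ _} (wi-one _) _ = [-]
WeaklyInc∧DesSub⇒Sorted {v = []}     (wi-cons _ _ _ _ _) _ = []
WeaklyInc∧DesSub⇒Sorted {v = _ ∷ []} (wi-cons _ _ _ _ _) _ = [-]
WeaklyInc∧DesSub⇒Sorted {v = p ∷ q ∷ v} (wi-cons a b u a≤b u↗) des =
  ⊑⇒colLeq (≤∧tie⇒⊑ a≤b tie) ∷ WeaklyInc∧DesSub⇒Sorted u↗ (des ∘ suc)
  where
  tie : a ≡ b → q ≤ p
  tie refl with des zero (a , a , refl , refl , ℕ.≤-refl)
  ... | _ , _ , refl , refl , q≤p = q≤p

Linked<⇒zip-↗ : ∀ {us} vs → Linked _<_ us → Sorted (zip us vs)
Linked<⇒zip-↗ _            []        = []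
Linked<⇒zip-↗ []           [-]       = []
Linked<⇒zip-↗ (_ ∷ _)      [-]       = [-]
Linked<⇒zip-↗ []           (_ ∷ _)   = []
Linked<⇒zip-↗ (_ ∷ [])     (_ ∷ _)   = [-]
Linked<⇒zip-↗ (_ ∷ q ∷ vs) (a<b ∷ us<) = ⊑⇒colLeq (top< a<b) ∷ Linked<⇒zip-↗ (q ∷ vs) us<

unzip-rows : ∀ {A B : Set} (L : List (A × B)) → unzip L ≡ (map proj₁ L , map proj₂ L)
unzip-rows []      = refl
unzip-rows (p ∷ L) = cong (λ (us , vs) → proj₁ p ∷ us , proj₂ p ∷ vs) (unzip-rows L)

rows-zip : ∀ {A B : Set} {us : List A} {vs : List B} → length us ≡ length vs →
           (map proj₁ (zip us vs) , map proj₂ (zip us vs)) ≡ (us , vs)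
rows-zip {us = us} {vs} |us|≡|vs| = trans (sym (unzip-rows (zip us vs))) (List.unzip-zip us vs |us|≡|vs|)

burgeT-top-↭ : ∀ u v → length u ≡ length v → proj₁ (burgeT u v) ↭ v
burgeT-top-↭ u v |u|≡|v| = begin
  proj₁ (burgeT u v)                  ≡⟨ cong proj₁ (unzip-rows (transposeCols (zip u v))) ⟩
  map proj₁ (transposeCols (zip u v)) ↭⟨ top-transposeCols-↭ (zip u v) ⟩
  map proj₂ (zip u v)                 ≡⟨ cong proj₂ (rows-zip |u|≡|v|) ⟩
  v                                   ∎
  where open PermutationReasoning

burgeT-bottom-↭ : ∀ u v → length u ≡ length v → proj₂ (burgeT u v) ↭ u
burgeT-bottom-↭ u v |u|≡|v| = begin
  proj₂ (burgeT u v)                  ≡⟨ cong proj₂ (unzip-rows (transposeCols (zip u v))) ⟩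
  map proj₂ (transposeCols (zip u v)) ↭⟨ bottom-transposeCols-↭ (zip u v) ⟩
  map proj₁ (zip u v)                 ≡⟨ cong proj₁ (rows-zip |u|≡|v|) ⟩
  u                                   ∎
  where open PermutationReasoning

burgeT-rows-sorted : ∀ u v → let (s , t) = burgeT u v in WeaklyInc s × DesSub s t
burgeT-rows-sorted u v = subst (λ (s , t) → WeaklyInc s × DesSub s t)
  (sym (unzip-rows (transposeCols (zip u v))))
  (Sorted⇒WeaklyInc (transposeCols-↗ (zip u v)) , Sorted⇒DesSub (transposeCols-↗ (zip u v)))

burgeT-involutive : ∀ {u v} → length u ≡ length v → Sorted (zip u v) →
                    uncurry′ burgeT (burgeT u v) ≡ (u , v)
burgeT-involutive {u} {v} |u|≡|v| uv↗ = begin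
  unzip (transposeCols (uncurry′ zip (unzip cols))) ≡⟨ cong (unzip ∘ transposeCols) (List.zip-unzip cols) ⟩
  unzip (transposeCols cols)                        ≡⟨ cong unzip (transposeCols-involutive uv↗) ⟩
  unzip (zip u v)                                   ≡⟨ List.unzip-zip u v |u|≡|v| ⟩
  (u , v)                                           ∎
  where
  open ≡-Reasoning
  cols : List Column
  cols = transposeCols (zip u v)

applyUpTo-Linked< : ∀ f → (∀ i → f i < f (suc i)) → ∀ n → Linked _<_ (applyUpTo f n)
applyUpTo-Linked< f f< zero          = []
applyUpTo-Linked< f f< (suc zero)    = [-]
applyUpTo-Linked< f f< (suc (suc n)) = f< 0 ∷ applyUpTo-Linked< (f ∘ suc) (f< ∘ suc) (suc n)

idW≡applyUpTo : ∀ n → idW n ≡ applyUpTo suc n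
idW≡applyUpTo n = List.map-applyUpTo id suc n

idW-suc : ∀ n → idW (suc n) ≡ 1 ∷ map suc (idW n)
idW-suc n = cong (1 ∷_) (cong (map suc) (sym (idW≡applyUpTo n)))

length-idW : ∀ n → length (idW n) ≡ n
length-idW n = trans (List.length-map suc (applyUpTo id n)) (List.length-upTo n)

zip-idW-↗ : ∀ n x → Sorted (zip (idW n) x)
zip-idW-↗ n x = subst (λ us → Sorted (zip us x)) (sym (idW≡applyUpTo n))
  (Linked<⇒zip-↗ x (applyUpTo-Linked< suc (λ i → ℕ.n<1+n (suc i)) n))

maxW-↭ : ∀ {x y} → x ↭ y → maxW x ≡ maxW y
maxW-↭ x↭y = foldr-commMonoid ℕ.⊔-0-isCommutativeMonoid (↭⇒↭ₛ x↭y)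

IsCayley-resp-↭ : ∀ {x y} → x ↭ y → IsCayley x → IsCayley y
IsCayley-resp-↭ x↭y (positive , surjective) =
  ↭.All-resp-↭ x↭y positive ,
  λ k 1≤k k≤max → ↭.∈-resp-↭ x↭y (surjective k 1≤k (subst (k ≤_) (sym (maxW-↭ x↭y)) k≤max))

pos-head : ∀ a w → pos a (a ∷ w) ≡ 1
pos-head a w with a ≟ a
... | yes _   = refl
... | no a≢a = ⊥-elim (a≢a refl)

pos-tail : ∀ {k a} w → k ≢ a → pos k (a ∷ w) ≡ suc (pos k w)
pos-tail {k} {a} w k≢a with k ≟ a
... | yes k≡a = ⊥-elim (k≢a k≡a)
... | no _    = refl

map-pos≡zip-idW : ∀ σ → Unique σ → map (λ k → (pos k σ , k)) σ ≡ zip (idW (length σ)) σ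
map-pos≡zip-idW []      _            = refl
map-pos≡zip-idW (a ∷ σ) (a∉σ ∷ σ!) = begin
  (pos a (a ∷ σ) , a) ∷ map (λ k → (pos k (a ∷ σ) , k)) σ
    ≡⟨ cong₂ _∷_ (cong (_, a) (pos-head a σ))
                 (List.map-cong-local (All.map (λ a≢k → cong (_, _) (pos-tail σ (a≢k ∘ sym))) a∉σ)) ⟩
  (1 , a) ∷ map (map₁ suc ∘ λ k → (pos k σ , k)) σ
    ≡⟨ cong ((1 , a) ∷_) (List.map-∘ σ) ⟩
  (1 , a) ∷ map (map₁ suc) (map (λ k → (pos k σ , k)) σ)
    ≡⟨ cong (λ cols → (1 , a) ∷ map (map₁ suc) cols) (map-pos≡zip-idW σ σ!) ⟩
  (1 , a) ∷ map (map₁ suc) (zip (idW (length σ)) σ)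
    ≡⟨ cong ((1 , a) ∷_) (List.zip-map suc id (idW (length σ)) σ) ⟨
  (1 , a) ∷ zip (map suc (idW (length σ))) (map id σ)
    ≡⟨ cong (λ w → (1 , a) ∷ zip (map suc (idW (length σ))) w) (List.map-id σ) ⟩
  zip (1 ∷ map suc (idW (length σ))) (a ∷ σ)
    ≡⟨ cong (λ us → zip us (a ∷ σ)) (idW-suc (length σ)) ⟨
  zip (idW (length (a ∷ σ))) (a ∷ σ)
    ∎
  where open ≡-Reasoning

map-swap-zip-map : ∀ (f : ℕ → ℕ) us → map swap (zip us (map f us)) ≡ map (λ k → (f k , k)) us
map-swap-zip-map f []       = refl
map-swap-zip-map f (u ∷ us) = cong (_ ∷_) (map-swap-zip-map f us)

γ-invP : ∀ σ → IsPerm σ → γ (invP σ) ≡ σ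
γ-invP σ σ↭id = begin
  proj₂ (burgeT (idW (length (invP σ))) (invP σ))
    ≡⟨ cong (λ m → proj₂ (burgeT (idW m) (invP σ))) (trans (List.length-map f (idW n)) (length-idW n)) ⟩
  proj₂ (unzip (sortCols (map swap (zip (idW n) (map f (idW n))))))
    ≡⟨ cong (proj₂ ∘ unzip ∘ sortCols) (map-swap-zip-map f (idW n)) ⟩
  proj₂ (unzip (sortCols (map (λ k → (f k , k)) (idW n))))
    ≡⟨ cong (proj₂ ∘ unzip) (sortCols-unique (zip-idW-↗ n σ) flipped-cols) ⟩
  proj₂ (unzip (zip (idW n) σ))
    ≡⟨ cong proj₂ (List.unzip-zip (idW n) σ (length-idW n)) ⟩
  σ ∎
  where
  open ≡-Reasoning
  n = length σ
  f = λ k → pos k σ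
  flipped-cols : zip (idW n) σ ↭ map (λ k → (f k , k)) (idW n)
  flipped-cols = subst (_↭ map (λ k → (f k , k)) (idW n))
    (map-pos≡zip-idW σ (Unique-resp-↭ (↭⇒↭ₛ (↭-sym σ↭id)) (Unique.map⁺ ℕ.suc-injective (Unique.upTo⁺ n))))
    (↭.map⁺ (λ k → (f k , k)) σ↭id)

InB-γ : ∀ {x} → IsCayley x → InB (γ x) x
InB-γ {x} x-cayley =
  u , (IsCayley-resp-↭ (↭-sym u↭x) x-cayley , burgeT-rows-sorted (idW n) x .proj₁ , |u|≡|π|
      , burgeT-rows-sorted (idW n) x .proj₂) , uπᵀ≡idx
  where
  n = length x
  |id|≡|x| : length (idW n) ≡ n
  |id|≡|x| = length-idW n
  u = proj₁ (burgeT (idW n) x)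
  π = γ x
  u↭x : u ↭ x
  u↭x = burgeT-top-↭ (idW n) x |id|≡|x|
  |π|≡n : length π ≡ n
  |π|≡n = trans (↭.↭-length (burgeT-bottom-↭ (idW n) x |id|≡|x|)) |id|≡|x|
  |u|≡|π| : length u ≡ length π
  |u|≡|π| = trans (↭.↭-length u↭x) (sym |π|≡n)
  uπᵀ≡idx : burgeT u π ≡ (idW (length π) , x)
  uπᵀ≡idx = subst (λ m → burgeT u π ≡ (idW m , x)) (sym |π|≡n)
    (burgeT-involutive |id|≡|x| (zip-idW-↗ n x))

InB⇔γ≡ : ∀ π x → InB π x ⇔ (IsCayley x × γ x ≡ π)
InB⇔γ≡ π x = mk⇔ to from
  where
  to : InB π x → IsCayley x × γ x ≡ π
  to (u , (u-cayley , u-wi , |u|≡|π| , u-des) , uπᵀ≡idx) = IsCayley-resp-↭ u↭x u-cayley , γx≡π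
    where
    open ≡-Reasoning
    u↭x : u ↭ x
    u↭x = subst (u ↭_) (cong proj₂ uπᵀ≡idx) (↭-sym (burgeT-bottom-↭ u π |u|≡|π|))
    γx≡π : γ x ≡ π
    γx≡π = begin
      proj₂ (burgeT (idW (length x)) x)
        ≡⟨ cong (λ m → proj₂ (burgeT (idW m) x)) (trans (sym (↭.↭-length u↭x)) |u|≡|π|) ⟩
      proj₂ (uncurry′ burgeT (idW (length π) , x))
        ≡⟨ cong (proj₂ ∘ uncurry′ burgeT) uπᵀ≡idx ⟨
      proj₂ (uncurry′ burgeT (burgeT u π))
        ≡⟨ cong proj₂ (burgeT-involutive |u|≡|π| (WeaklyInc∧DesSub⇒Sorted u-wi u-des)) ⟩
      π ∎
  from : IsCayley x × γ x ≡ π → InB π x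
  from (x-cayley , γx≡π) = subst (λ π → InB π x) γx≡π (InB-γ x-cayley)

mainTheorem15 : (∀ y → IsCayley y → ∀ x → InClass y x ⇔ InB (γ y) x)
    × (∀ σ → IsPerm σ → ∀ x → InB σ x ⇔ InClass (invP σ) x)
mainTheorem15 =
  (λ y _ x → ⇔-sym (InB⇔γ≡ (γ y) x)) ,
  (λ σ σ-perm x → subst (λ π → InB σ x ⇔ (IsCayley x × γ x ≡ π)) (sym (γ-invP σ σ-perm)) (InB⇔γ≡ σ x))
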